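{- Let $I=\langle X,\mathcal S,G=(V,A),c,p,r,B\rangle$ be an instance of \textbf{DCBC} and let $G'=(V',A')$ and (LP-DCBC) be as defined in the context. For any feasible solution $T_B$ of $I$ there exists a feasible solution $\{y_v,f^v_P\}_{v\in V',P\in\mathcal P_v}$ of (LP-DCBC) such that $p(T_B)=\sum_{v\in V'}y_vp_v$.
   Context: \textbf{DCBC} instance: finite ground set $X$, collection $\mathcal S\subseteq 2^X$, directed graph $G=(V,A)$ with each node $v$ associated with $S_v\in\mathcal S$, root $r\in V$, costs $c:V\to\mathbb R_{\ge0}$, prizes $p:X\to\mathbb R_{\ge0}$, budget $B>0$. A feasible solution is an out-tree $T$ of $G$ rooted at $r$ (exactly one directed path from $r$ to each node of $T$) with $\sum_{v\in V(T)}c(v)\le B$; its prize is $p(T)=\sum_{x\in\bigcup_{v\in V(T)}S_v}p(x)$. The graph $G'=(V',A')$ has $V'=V\cup W$, $W=\{w_x:x\in X\}$ (new nodes), $A'=A\cup\{(v,w_x):v\in V,x\in S_v\}$; costs $c_v=c(v)$, prizes $p_v=0$ for $v\in V$ and $c_{w_x}=0$, $p_{w_x}=p(x)$. For $v\in V'$, $\mathcal P_v$ is the set of simple directed paths from $r$ to $v$ in $G'$. (LP-DCBC): maximize $\sum_{v\in V'}y_vp_v$ subject to $\sum_{v\in V'}y_vc_v\le B$; $\sum_{P\in\mathcal P_v}f^v_P=y_v$ for all $v\in V'\setminus\{r\}$; $\sum_{P\in\mathcal P_v:\,z\in P}f^v_P\le y_z$ for all $z,v\in V'\setminus\{r\}$;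 $0\le y_v\le 1$; $0\le f^v_P\le 1$.
   Formalization: The costs c, prizes p and budget B are rational rather than real, and the variables $y_v$ and $f^v_P$ of (LP-DCBC) are taken in ℚ. -}

module Defs where

open import Data.Nat using (ℕ; zero; suc)
open import Data.Fin using (Fin; zero; suc)
import Data.Fin.Properties as FinP
open import Data.Fin.Subset using (Subset)
open import Data.Vec using (lookup)
open import Data.Bool using (Bool; true; false; if_then_else_; _∧_; _∨_)
open import Data.Sum using (_⊎_; inj₁; inj₂)
open import Data.Sum.Properties using (≡-dec)
open import Data.List using (List; []; _∷_; map)
open import Data.List.Relation.Unary.All using (All)
open import Data.List.Relation.Unary.Unique.Propositional using (Unique)
open import Data.Product using (Σ; _×_; _,_; proj₁; proj₂; ∃)
open import Data.Rational using (ℚ; 0ℚ; 1ℚ; _+_; _*_; _≤_; _<_)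
open import Relation.Binary.PropositionalEquality using (_≡_)
open import Relation.Nullary using (¬_; does)

sumFin : (n : ℕ) → (Fin n → ℚ) → ℚ
sumFin zero    f = 0ℚ
sumFin (suc n) f = f zero + sumFin n (λ i → f (suc i))

anyFin : (n : ℕ) → (Fin n → Bool) → Bool
anyFin zero    f = false
anyFin (suc n) f = f zero ∨ anyFin n (λ i → f (suc i))

data Walk {V : Set} (E : V → V → Set) : V → V → List V → Set where
  here : (u : V) → Walk E u u (u ∷ [])
  step : {u w v : V} {vs : List V} → E u w → Walk E w v vs → Walk E u v (u ∷ vs)

SimplePath : {V : Set} → (V → V → Set) → V → V → List V → Set
SimplePath E u v vs = Walk E u v vs × Unique vs

-- DCBC instance data (n = |V|, m = |X|); V = Fin n, X = Fin m.
-- A : arc relation of G; S v : the set S_v ⊆ X (as a subset of Fin m).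

record OutTree (n : ℕ) (A : Fin n → Fin n → Set) (r : Fin n) : Set where
  field
    inT      : Fin n → Bool
    arcT     : Fin n → Fin n → Bool
    arcT⊆A   : ∀ u w → arcT u w ≡ true → A u w
    arcT-in  : ∀ u w → arcT u w ≡ true → (inT u ≡ true) × (inT w ≡ true)
    root-in  : inT r ≡ true
    unique-path : ∀ v → inT v ≡ true →
      Σ (List (Fin n)) λ vs →
        Walk (λ a b → arcT a b ≡ true) r v vs ×
        (∀ ws → Walk (λ a b → arcT a b ≡ true) r v ws → ws ≡ vs)

open OutTree public

treeCost : {n : ℕ} {A : Fin n → Fin n → Set} {r : Fin n} →
           (Fin n → ℚ) → OutTree n A r → ℚ
treeCost {n} c T = sumFin n (λ v → if inT T v then c v else 0ℚ)

treePrize : {n m : ℕ} {A : Fin n → Fin n → Set} {r : Fin n} →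
            (Fin n → Subset m) → (Fin m → ℚ) → OutTree n A r → ℚ
treePrize {n} {m} S p T =
  sumFin m (λ x → if anyFin n (λ v → inT T v ∧ lookup (S v) x) then p x else 0ℚ)

Feasible : {n : ℕ} {A : Fin n → Fin n → Set} {r : Fin n} →
           (Fin n → ℚ) → ℚ → OutTree n A r → Set
Feasible c B T = treeCost c T ≤ B

-- The graph G' = (V ⊎ W, A') with W = {w_x : x ∈ X} ≅ Fin m.

V' : ℕ → ℕ → Set
V' n m = Fin n ⊎ Fin m

data A' {n m : ℕ} (A : Fin n → Fin n → Set) (S : Fin n → Subset m)
     : V' n m → V' n m → Set where
  old : ∀ {u w} → A u w → A' A S (inj₁ u) (inj₁ w)
  new : ∀ {v x} → lookup (S v) x ≡ true → A' A S (inj₁ v) (inj₂ x)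

c' : {n m : ℕ} → (Fin n → ℚ) → V' n m → ℚ
c' c (inj₁ v) = c v
c' c (inj₂ x) = 0ℚ

p' : {n m : ℕ} → (Fin m → ℚ) → V' n m → ℚ
p' p (inj₁ v) = 0ℚ
p' p (inj₂ x) = p x

sumV' : (n m : ℕ) → (V' n m → ℚ) → ℚ
sumV' n m f = sumFin n (λ v → f (inj₁ v)) + sumFin m (λ x → f (inj₂ x))

memB : {n m : ℕ} → V' n m → List (V' n m) → Bool
memB z []      = false
memB z (u ∷ P) = does (≡-dec FinP._≟_ FinP._≟_ z u) ∨ memB z P

sumW : {V : Set} → List (List V × ℚ) → ℚ
sumW []            = 0ℚ
sumW ((P , w) ∷ l) = w + sumW l

sumWthrough : {n m : ℕ} → V' n m → List (List (V' n m) × ℚ) → ℚ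
sumWthrough z []            = 0ℚ
sumWthrough z ((P , w) ∷ l) = (if memB z P then w else 0ℚ) + sumWthrough z l

-- The flow f^v (a function on the finite set 𝒫_v) is represented by its
-- support: a list of pairwise distinct simple r–v paths in G' with weights;
-- f^v_P = 0 for every simple path P not in the list.
record LPSol (n m : ℕ) (A : Fin n → Fin n → Set) (S : Fin n → Subset m)
             (r : Fin n) (c : Fin n → ℚ) (B : ℚ) : Set where
  field
    y        : V' n m → ℚ
    f        : V' n m → List (List (V' n m) × ℚ)
    f-paths  : ∀ v → All (λ Pw → SimplePath (A' A S) (inj₁ r) v (proj₁ Pw)) (f v)
    f-distinct : ∀ v → Unique (map proj₁ (f v))
    budget   : sumV' n m (λ v → y v * c' c v) ≤ B
    flow     : ∀ v → ¬ (v ≡ inj₁ r) → sumW (f v) ≡ y v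
    capacity : ∀ z v → ¬ (z ≡ inj₁ r) → ¬ (v ≡ inj₁ r) → sumWthrough z (f v) ≤ y z
    y-lo     : ∀ v → 0ℚ ≤ y v
    y-hi     : ∀ v → y v ≤ 1ℚ
    f-lo     : ∀ v → All (λ Pw → 0ℚ ≤ proj₂ Pw) (f v)
    f-hi     : ∀ v → All (λ Pw → proj₂ Pw ≤ 1ℚ) (f v)

open LPSol public

{-# OPTIONS --safe #-}
-- Let y be the indicator of the nodes of T together with the prize nodes w_x
-- of the elements x covered by T, and send one unit of flow to each such node
-- along a single simple path from r inside this set: the tree path to v,
-- followed by the arc (v, w_x) for a prize node (a walk is shortened to a
-- simple path by cutting out cycles).  Every node on such a path has y = 1,
-- which gives the capacity constraints, and the cost and prize of y are
-- exactly those of T.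
module Submission where

open import Defs
open import Data.Nat using (ℕ; zero; suc)
open import Data.Fin using (Fin; zero; suc)
import Data.Fin.Properties as FinP
open import Data.Fin.Subset using (Subset)
open import Data.Vec using (lookup)
open import Data.Bool using (Bool; true; false; if_then_else_; _∧_)
open import Data.Bool.Properties using (∧-conicalˡ; ∧-conicalʳ)
open import Data.Sum using (inj₁; inj₂)
open import Data.Sum.Properties using (≡-dec)
open import Data.List using (List; []; _∷_; _++_; [_]; map)
open import Data.List.Membership.Propositional using (_∈_)
open import Data.List.Relation.Binary.Subset.Propositional using (_⊆_)
open import Data.List.Relation.Binary.Subset.Propositional.Properties
  using (⊆-refl; ⊆-trans; xs⊆x∷xs; ∷⁺ʳ)
open import Data.List.Relation.Unary.All as All using (All; []; _∷_)
import Data.List.Relation.Unary.All.Properties as AllP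
open import Data.List.Relation.Unary.Any using (here; there)
open import Data.List.Relation.Unary.AllPairs using ([]; _∷_)
open import Data.List.Relation.Unary.Unique.Propositional using (Unique)
open import Data.Product using (Σ; ∃; _×_; _,_; proj₁; proj₂)
open import Data.Rational using (ℚ; 0ℚ; 1ℚ; _+_; _*_; _≤_; _<_)
import Data.Rational.Properties as ℚ
open import Relation.Binary using (DecidableEquality)
open import Relation.Binary.PropositionalEquality using (_≡_; refl; sym; trans; cong₂; subst)
open import Relation.Nullary using (yes; no)

module _ {V : Set} {E : V → V → Set} where

  Walk-snoc : ∀ {u v w vs} → Walk E u v vs → E v w → Walk E u w (vs ++ [ w ])
  Walk-snoc (here _)   e = step e (here _)
  Walk-snoc (step d W) e = step d (Walk-snoc W e)

  Walk-All : {P : V → Set} → (∀ {a b} → E a b → P b) →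
             ∀ {u v vs} → P u → Walk E u v vs → All P vs
  Walk-All closed pu (here _)   = pu ∷ []
  Walk-All closed pu (step e W) = pu ∷ Walk-All closed (closed e) W

Walk-map : {V U : Set} {E : V → V → Set} {F : U → U → Set} (f : V → U) →
           (∀ {a b} → E a b → F (f a) (f b)) →
           ∀ {u v vs} → Walk E u v vs → Walk F (f u) (f v) (map f vs)
Walk-map f hom (here u)   = here (f u)
Walk-map f hom (step e W) = step (hom e) (Walk-map f hom W)

module _ {V : Set} (_≟_ : DecidableEquality V) {E : V → V → Set} where
  open import Data.List.Membership.DecPropositional _≟_ using (_∈?_)

  SimplePath-suffix : ∀ {u w v ws} → Walk E w v ws → Unique ws → u ∈ ws →
                      ∃ λ us → SimplePath E u v us × us ⊆ ws
  SimplePath-suffix W@(here _)   uq       (here refl) = _ , (W , uq) , ⊆-refl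
  SimplePath-suffix W@(step _ _) uq       (here refl) = _ , (W , uq) , ⊆-refl
  SimplePath-suffix (step _ W)   (_ ∷ uq) (there u∈ws) with SimplePath-suffix W uq u∈ws
  ... | us , P , us⊆ws = us , P , ⊆-trans us⊆ws (xs⊆x∷xs _ _)

  Walk⇒SimplePath : ∀ {u v vs} → Walk E u v vs → ∃ λ ws → SimplePath E u v ws × ws ⊆ vs
  Walk⇒SimplePath (here u) = _ , (here u , [] ∷ []) , ⊆-refl
  Walk⇒SimplePath {u} (step e W) with Walk⇒SimplePath W
  ... | ws , (W′ , uq) , ws⊆vs with u ∈? ws
  ... | no u∉ws  = u ∷ ws , (step e W′ , AllP.¬Any⇒All¬ ws u∉ws ∷ uq) , ∷⁺ʳ u ws⊆vs
  ... | yes u∈ws with SimplePath-suffix W′ uq u∈ws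
  ...   | us , P , us⊆ws = us , P , ⊆-trans us⊆ws (⊆-trans ws⊆vs (xs⊆x∷xs _ u))

sumFin-cong : ∀ n {f g : Fin n → ℚ} → (∀ i → f i ≡ g i) → sumFin n f ≡ sumFin n g
sumFin-cong zero    f≡g = refl
sumFin-cong (suc n) f≡g = cong₂ _+_ (f≡g zero) (sumFin-cong n (λ i → f≡g (suc i)))

sumFin-zero : ∀ n {f : Fin n → ℚ} → (∀ i → f i ≡ 0ℚ) → sumFin n f ≡ 0ℚ
sumFin-zero zero    f≡0 = refl
sumFin-zero (suc n) f≡0 =
  trans (cong₂ _+_ (f≡0 zero) (sumFin-zero n (λ i → f≡0 (suc i)))) (ℚ.+-identityʳ 0ℚ)

anyFin-witness : ∀ n {f : Fin n → Bool} → anyFin n f ≡ true → ∃ λ i → f i ≡ true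
anyFin-witness (suc n) {f} any≡true with f zero in f0
... | true  = zero , f0
... | false with anyFin-witness n any≡true
...   | i , fi = suc i , fi

ind : Bool → ℚ
ind b = if b then 1ℚ else 0ℚ

ind-* : ∀ b q → ind b * q ≡ (if b then q else 0ℚ)
ind-* true  q = ℚ.*-identityˡ q
ind-* false q = ℚ.*-zeroˡ q

0≤ind : ∀ b → 0ℚ ≤ ind b
0≤ind true  = ℚ.nonNegative⁻¹ 1ℚ
0≤ind false = ℚ.≤-refl

ind≤1 : ∀ b → ind b ≤ 1ℚ
ind≤1 true  = ℚ.≤-refl
ind≤1 false = ℚ.nonNegative⁻¹ 1ℚ

ind-mono : ∀ {a b} → (a ≡ true → b ≡ true) → ind a ≤ ind b
ind-mono {true}  a⇒b rewrite a⇒b refl = ℚ.≤-refl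
ind-mono {false} {b} _ = 0≤ind b

memB⇒∈ : ∀ {n m} {z : V' n m} ws → memB z ws ≡ true → z ∈ ws
memB⇒∈ {z = z} (u ∷ ws) z∈? with ≡-dec FinP._≟_ FinP._≟_ z u
... | yes refl = here refl
... | no  _    = there (memB⇒∈ ws z∈?)

module IndicatorSolution {n m : ℕ} (A : Fin n → Fin n → Set) (S : Fin n → Subset m)
         (r : Fin n) (good : V' n m → Bool) where

  GoodPath : V' n m → Set
  GoodPath z = ∃ λ ws → SimplePath (A' A S) (inj₁ r) z ws × All (λ u → good u ≡ true) ws

  unitFlow : ∀ {z} b → (b ≡ true → GoodPath z) → List (List (V' n m) × ℚ)
  unitFlow true  P = (proj₁ (P refl) , 1ℚ) ∷ []
  unitFlow false P = []

  module _ {z : V' n m} where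

    unitFlow-paths : ∀ b (P : b ≡ true → GoodPath z) →
      All (λ Pw → SimplePath (A' A S) (inj₁ r) z (proj₁ Pw)) (unitFlow b P)
    unitFlow-paths true  P = let _ , path , _ = P refl in path ∷ []
    unitFlow-paths false P = []

    unitFlow-distinct : ∀ b (P : b ≡ true → GoodPath z) → Unique (map proj₁ (unitFlow b P))
    unitFlow-distinct true  P = [] ∷ []
    unitFlow-distinct false P = []

    unitFlow-value : ∀ b (P : b ≡ true → GoodPath z) → sumW (unitFlow b P) ≡ ind b
    unitFlow-value true  P = ℚ.+-identityʳ 1ℚ
    unitFlow-value false P = refl

    unitFlow-through : ∀ w b (P : b ≡ true → GoodPath z) → sumWthrough w (unitFlow b P) ≤ ind (good w)
    unitFlow-through w true P = let ws , _ , ws-good = P refl in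
      subst (_≤ ind (good w)) (sym (ℚ.+-identityʳ _))
            (ind-mono (λ w∈? → All.lookup ws-good (memB⇒∈ ws w∈?)))
    unitFlow-through w false P = 0≤ind (good w)

    unitFlow-lo : ∀ b (P : b ≡ true → GoodPath z) → All (λ Pw → 0ℚ ≤ proj₂ Pw) (unitFlow b P)
    unitFlow-lo true  P = 0≤ind true ∷ []
    unitFlow-lo false P = []

    unitFlow-hi : ∀ b (P : b ≡ true → GoodPath z) → All (λ Pw → proj₂ Pw ≤ 1ℚ) (unitFlow b P)
    unitFlow-hi true  P = ℚ.≤-refl ∷ []
    unitFlow-hi false P = []

  indicatorSolution : (∀ z → good z ≡ true → GoodPath z) → (c : Fin n → ℚ) (B : ℚ) →
                      sumV' n m (λ v → ind (good v) * c' c v) ≤ B → LPSol n m A S r c B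
  indicatorSolution path c B budget = record
    { y          = λ z → ind (good z)
    ; f          = λ z → unitFlow (good z) (path z)
    ; f-paths    = λ z → unitFlow-paths (good z) (path z)
    ; f-distinct = λ z → unitFlow-distinct (good z) (path z)
    ; budget     = budget
    ; flow       = λ z _ → unitFlow-value (good z) (path z)
    ; capacity   = λ w z _ _ → unitFlow-through w (good z) (path z)
    ; y-lo       = λ z → 0≤ind (good z)
    ; y-hi       = λ z → ind≤1 (good z)
    ; f-lo       = λ z → unitFlow-lo (good z) (path z)
    ; f-hi       = λ z → unitFlow-hi (good z) (path z)
    }

module TreeImage {n m : ℕ} {A : Fin n → Fin n → Set} (S : Fin n → Subset m)
         {r : Fin n} (T : OutTree n A r) where

  covered : Fin m → Bool
  covered x = anyFin n (λ v → inT T v ∧ lookup (S v) x)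

  inImage : V' n m → Bool
  inImage (inj₁ v) = inT T v
  inImage (inj₂ x) = covered x

  open IndicatorSolution A S r inImage using (GoodPath)

  ImageWalk : V' n m → Set
  ImageWalk z = ∃ λ ws → Walk (A' A S) (inj₁ r) z ws × All (λ u → inImage u ≡ true) ws

  treeWalk : ∀ {v} → inT T v ≡ true → ImageWalk (inj₁ v)
  treeWalk v∈T =
    let vs , W , _ = unique-path T _ v∈T
    in  map inj₁ vs
      , Walk-map inj₁ (λ e → old (arcT⊆A T _ _ e)) W
      , AllP.map⁺ (Walk-All (λ e → proj₂ (arcT-in T _ _ e)) (root-in T) W)

  imageWalk : ∀ z → inImage z ≡ true → ImageWalk z
  imageWalk (inj₁ v) v∈T = treeWalk v∈T
  imageWalk (inj₂ x) x-covered =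
    let v , q        = anyFin-witness n x-covered
        ws , W , all = treeWalk (∧-conicalˡ _ _ q)
    in  ws ++ [ inj₂ x ]
      , Walk-snoc W (new (∧-conicalʳ _ _ q))
      , AllP.++⁺ all (x-covered ∷ [])

  imagePath : ∀ z → inImage z ≡ true → GoodPath z
  imagePath z z∈image =
    let ws , W , all  = imageWalk z z∈image
        us , P , us⊆ws = Walk⇒SimplePath (≡-dec FinP._≟_ FinP._≟_) W
    in  us , P , AllP.anti-mono us⊆ws all

  image-cost : ∀ c → sumV' n m (λ v → ind (inImage v) * c' c v) ≡ treeCost c T
  image-cost c =
    trans (cong₂ _+_ (sumFin-cong n (λ v → ind-* (inT T v) (c v)))
                     (sumFin-zero m (λ x → ℚ.*-zeroʳ (ind (covered x)))))
          (ℚ.+-identityʳ _)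

  image-prize : ∀ p → sumV' n m (λ v → ind (inImage v) * p' p v) ≡ treePrize S p T
  image-prize p =
    trans (cong₂ _+_ (sumFin-zero n (λ v → ℚ.*-zeroʳ (ind (inT T v))))
                     (sumFin-cong m (λ x → ind-* (covered x) (p x))))
          (ℚ.+-identityˡ _)

lemma1 : (n m : ℕ) (A : Fin n → Fin n → Set) (S : Fin n → Subset m)
         (r : Fin n) (c : Fin n → ℚ) (p : Fin m → ℚ) (B : ℚ) →
         (∀ v → 0ℚ ≤ c v) → (∀ x → 0ℚ ≤ p x) → 0ℚ < B →
         (T : OutTree n A r) → Feasible c B T →
         Σ (LPSol n m A S r c B) λ L →
           treePrize S p T ≡ sumV' n m (λ v → y L v * p' p v)
lemma1 n m A S r c p B _ _ _ T feasible =
    indicatorSolution imagePath c B (subst (_≤ B) (sym (image-cost c)) feasible)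
  , sym (image-prize p)
  where
  open TreeImage S T
  open IndicatorSolution A S r inImage
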